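{- Let $\lambda_1,\lambda_2 \in \mathbb{N}$ be two coprime positive integers such that $\lambda_1 \equiv \lambda_2+1 \pmod{3}$, and let $S=\{0,\lambda_1,\lambda_1+\lambda_2\}$. Let $A\subset \mathbb{Z}$ be a set containing no translate $S+u=\{u,u+\lambda_1,u+\lambda_1+\lambda_2\}$, $u\in\mathbb{Z}$, of $S$. For $t\in \mathbb{Z}$, let $I_1(t)=\{t+1,\dots,t+2\lambda_1+\lambda_2\}$ and $I_2(t)=I_1(t)+\lambda_1+\lambda_2=\{t+\lambda_1+\lambda_2+1,\dots,t+3\lambda_1+2\lambda_2\}$. Then for every $t\in\mathbb{Z}$, \[ 2|I_1(t)\setminus A|+|I_2(t)\setminus A|\geq 2\lambda_1+\lambda_2. \] -}

module Defs where

open import Data.Bool using (Bool; true; false)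
open import Data.Nat using (ℕ; zero; suc)
open import Data.Integer using (ℤ; +_; _+_)
open import Data.Product using (_×_)
open import Relation.Binary.PropositionalEquality using (_≡_)

missing : (ℤ → Bool) → ℤ → ℕ → ℕ
missing A a zero = 0
missing A a (suc n) with A (a + + suc n)
... | true  = missing A a n
... | false = suc (missing A a n)

TranslateIn : (ℤ → Bool) → ℕ → ℕ → ℤ → Set
TranslateIn A l₁ l₂ u =
  (A u ≡ true) × (A (u + + l₁) ≡ true) × (A (u + + l₁ + + l₂) ≡ true)

{-# OPTIONS --safe #-}
module Submission where

-- Since S + u ⊄ A, every u ∈ I₁(t) can be charged to the first point of S + u missing from A.
-- Charges landing on u itself count I₁ \ A. Charges landing on u + λ₁ hit distinct missing
-- points of I₁, or of I₂ \ I₁ when u > t + λ₁ + λ₂; charges landing on u + λ₁ + λ₂ hit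
-- distinct missing points of I₂. So a point can be charged twice only if it is w = v + 2λ₁ + λ₂
-- with t < v ≤ t + λ₁, charged from v + λ₁ and from v + λ₁ + λ₂; then both these points lie
-- in A, hence v ∉ A, and v is a point of I₁ \ A that receives no charge at a later position.
-- Thus |I₁| ≤ |I₁ \ A| + (|I₁ \ A| + |I₂ \ A|).

open import Defs
open import Data.Bool using (Bool; true; false; _∧_; if_then_else_)
open import Data.Nat using (ℕ; zero; suc; _+_; _*_; _%_; _≤_; _<_; z≤n; s≤s)
open import Data.Nat.Properties using (+-comm; +-assoc; +-suc; +-identityʳ; ≤-refl; ≤-trans; +-mono-≤; module ≤-Reasoning)
open import Data.Nat.Tactic.RingSolver using (solve-∀)
open import Data.Nat.Coprimality using (Coprime)
open import Data.Integer using (ℤ; +_)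
import Data.Integer as ℤ
import Data.Integer.Properties as ℤ
open import Data.Product using (_×_; _,_)
open import Data.Empty using (⊥-elim)
open import Relation.Binary.PropositionalEquality using (_≡_; refl; sym; trans; cong; cong₂; subst₂; module ≡-Reasoning)
open import Relation.Nullary using (¬_)

∑ : (ℕ → ℕ) → ℕ → ℕ
∑ f zero    = 0
∑ f (suc n) = f (suc n) + ∑ f n

∑-cong : ∀ {f g} → (∀ i → f i ≡ g i) → ∀ n → ∑ f n ≡ ∑ g n
∑-cong f≡g zero    = refl
∑-cong f≡g (suc n) = cong₂ _+_ (f≡g (suc n)) (∑-cong f≡g n)

∑-mono-≤ : ∀ {f g} → (∀ i → f i ≤ g i) → ∀ n → ∑ f n ≤ ∑ g n
∑-mono-≤ f≤g zero    = z≤n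
∑-mono-≤ f≤g (suc n) = +-mono-≤ (f≤g (suc n)) (∑-mono-≤ f≤g n)

∑-const-1 : ∀ n → ∑ (λ _ → 1) n ≡ n
∑-const-1 zero    = refl
∑-const-1 (suc n) = cong suc (∑-const-1 n)

∑-distrib-+ : ∀ f g n → ∑ (λ i → f i + g i) n ≡ ∑ f n + ∑ g n
∑-distrib-+ f g zero    = refl
∑-distrib-+ f g (suc n) = begin
  f (suc n) + g (suc n) + ∑ (λ i → f i + g i) n ≡⟨ cong (λ s → f (suc n) + g (suc n) + s) (∑-distrib-+ f g n) ⟩
  f (suc n) + g (suc n) + (∑ f n + ∑ g n)       ≡⟨ interchange (f (suc n)) (g (suc n)) (∑ f n) (∑ g n) ⟩
  f (suc n) + ∑ f n + (g (suc n) + ∑ g n)       ∎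
  where
  open ≡-Reasoning
  interchange : ∀ a b c d → a + b + (c + d) ≡ a + c + (b + d)
  interchange = solve-∀

∑-split : ∀ f m n → ∑ f (m + n) ≡ ∑ f m + ∑ (λ i → f (m + i)) n
∑-split f m zero    = trans (cong (∑ f) (+-identityʳ m)) (sym (+-identityʳ (∑ f m)))
∑-split f m (suc n) = begin
  ∑ f (m + suc n)                                   ≡⟨ cong (∑ f) (+-suc m n) ⟩
  f (suc (m + n)) + ∑ f (m + n)                     ≡⟨ cong (λ s → f (suc (m + n)) + s) (∑-split f m n) ⟩
  f (suc (m + n)) + (∑ f m + ∑ (λ i → f (m + i)) n) ≡⟨ left-comm (f (suc (m + n))) (∑ f m) _ ⟩
  ∑ f m + (f (suc (m + n)) + ∑ (λ i → f (m + i)) n) ≡⟨ cong (λ p → ∑ f m + (f p + ∑ (λ i → f (m + i)) n)) (sym (+-suc m n)) ⟩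
  ∑ f m + (f (m + suc n) + ∑ (λ i → f (m + i)) n)   ∎
  where
  open ≡-Reasoning
  left-comm : ∀ a b c → a + (b + c) ≡ b + (a + c)
  left-comm = solve-∀

∑-split₃ : ∀ f a b c →
  ∑ f (a + (b + c)) ≡ ∑ f a + (∑ (λ i → f (a + i)) b + ∑ (λ i → f (a + (b + i))) c)
∑-split₃ f a b c = trans (∑-split f a (b + c)) (cong (λ s → ∑ f a + s) (∑-split (λ i → f (a + i)) b c))

absent : Bool → ℕ
absent true  = 0
absent false = 1

missing-as-∑ : ∀ A a n → missing A a n ≡ ∑ (λ i → absent (A (a ℤ.+ + i))) n
missing-as-∑ A a zero = refl
missing-as-∑ A a (suc n) with A (a ℤ.+ + suc n)
... | true  = missing-as-∑ A a n
... | false = cong suc (missing-as-∑ A a n)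

if-then-0-≤ : ∀ b n → (if b then n else 0) ≤ n
if-then-0-≤ true  n = ≤-refl
if-then-0-≤ false n = z≤n

first-absent-charge : ∀ x y w → ¬ (x ≡ true × y ≡ true × w ≡ true) →
  1 ≤ absent x + (if x then absent y else 0) + (if x ∧ y then absent w else 0)
first-absent-charge false y     w     _    = s≤s z≤n
first-absent-charge true  false w     _    = s≤s z≤n
first-absent-charge true  true  false _    = s≤s z≤n
first-absent-charge true  true  true  ¬xyw = ⊥-elim (¬xyw (refl , refl , refl))

shared-charge : ∀ x y w q v → ¬ (x ≡ true × y ≡ true × w ≡ true) →
  (if y ∧ q then absent v else 0) + (if w then absent v else 0) ≤ absent x + absent v
shared-charge x     y     w     q true  _    = ≤-trans (+-mono-≤ (if-then-0-≤ (y ∧ q) 0) (if-then-0-≤ w 0)) z≤n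
shared-charge false y     w     q false _    = +-mono-≤ (if-then-0-≤ (y ∧ q) 1) (if-then-0-≤ w 1)
shared-charge true  false w     q false _    = if-then-0-≤ w 1
shared-charge true  true  false q false _    = +-mono-≤ (if-then-0-≤ q 1) z≤n
shared-charge true  true  true  q false ¬xyw = ⊥-elim (¬xyw (refl , refl , refl))

module Charging (P : ℕ → Bool) (l k : ℕ)
  (avoids : ∀ u → ¬ (P u ≡ true × P (l + u) ≡ true × P (l + k + u) ≡ true)) where

  gap gap₂ : ℕ → ℕ
  gap  p = absent (P p)
  gap₂ p = gap (l + k + p)

  second third : ℕ → ℕ
  second u = if P u then gap (l + u) else 0
  third  u = if P u ∧ P (l + u) then gap₂ u else 0

  n : ℕ
  n = 2 * l + k

  n≡l+[l+k] : n ≡ l + (l + k)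
  n≡l+[l+k] = shape l k
    where
    shape : ∀ l k → 2 * l + k ≡ l + (l + k)
    shape = solve-∀

  ∑-split-n-at-l : ∀ f → ∑ f n ≡ ∑ f l + ∑ (λ i → f (l + i)) (l + k)
  ∑-split-n-at-l f = trans (cong (∑ f) n≡l+[l+k]) (∑-split f l (l + k))

  ∑-split-n-at-l,2l : ∀ f → ∑ f n ≡ ∑ f l + (∑ (λ i → f (l + i)) l + ∑ (λ i → f (l + (l + i))) k)
  ∑-split-n-at-l,2l f = trans (cong (∑ f) n≡l+[l+k]) (∑-split₃ f l l k)

  ∑-split-n-at-l+k : ∀ f → ∑ f n ≡ ∑ f (l + k) + ∑ (λ i → f (l + k + i)) l
  ∑-split-n-at-l+k f = trans (cong (∑ f) (trans n≡l+[l+k] (+-comm l (l + k)))) (∑-split f (l + k) l)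

  charge-≥-1 : ∀ u → 1 ≤ gap u + second u + third u
  charge-≥-1 u = first-absent-charge (P u) (P (l + u)) (P (l + k + u)) (avoids u)

  third+second-≤ : ∀ i → third (l + i) + second (l + k + i) ≤ gap i + gap₂ (l + i)
  third+second-≤ i = begin
    third (l + i) + second (l + k + i)
      ≡⟨ cong (λ p → third (l + i) + (if P (l + k + i) then gap p else 0)) (reorder l k i) ⟩
    third (l + i) + (if P (l + k + i) then gap₂ (l + i) else 0)
      ≤⟨ shared-charge (P i) (P (l + i)) (P (l + k + i)) (P (l + (l + i))) (P (l + k + (l + i))) (avoids i) ⟩
    gap i + gap₂ (l + i) ∎
    where
    open ≤-Reasoning
    reorder : ∀ l k i → l + (l + k + i) ≡ l + k + (l + i)
    reorder = solve-∀

  third-≤ : ∀ u → third u ≤ gap₂ u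
  third-≤ u = if-then-0-≤ (P u ∧ P (l + u)) (gap₂ u)

  later-charges-≤ : ∑ second n + ∑ third n ≤ ∑ gap n + ∑ gap₂ n
  later-charges-≤ = begin
    ∑ second n + ∑ third n
      ≡⟨ cong₂ _+_ (∑-split-n-at-l+k second) (∑-split-n-at-l,2l third) ⟩
    (B₁ + B₂) + (C₁ + (C₂ + C₃))
      ≡⟨ regroup B₁ B₂ C₁ C₂ C₃ ⟩
    B₁ + (C₁ + C₃) + (C₂ + B₂)
      ≤⟨ +-mono-≤ (+-mono-≤ (∑-mono-≤ (λ u → if-then-0-≤ (P u) (gap (l + u))) (l + k))
                            (+-mono-≤ (∑-mono-≤ third-≤ l) (∑-mono-≤ (λ i → third-≤ (l + (l + i))) k)))
                  (subst₂ _≤_ (∑-distrib-+ _ _ l) (∑-distrib-+ _ _ l) (∑-mono-≤ third+second-≤ l)) ⟩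
    X₂ + (Y₁ + Y₃) + (X₁ + Y₂)
      ≡⟨ regroup′ X₂ X₁ Y₁ Y₂ Y₃ ⟩
    (X₁ + X₂) + (Y₁ + (Y₂ + Y₃))
      ≡⟨ sym (cong₂ _+_ (∑-split-n-at-l gap) (∑-split-n-at-l,2l gap₂)) ⟩
    ∑ gap n + ∑ gap₂ n ∎
    where
    open ≤-Reasoning
    B₁ B₂ C₁ C₂ C₃ X₁ X₂ Y₁ Y₂ Y₃ : ℕ
    B₁ = ∑ second (l + k)
    B₂ = ∑ (λ i → second (l + k + i)) l
    C₁ = ∑ third l
    C₂ = ∑ (λ i → third (l + i)) l
    C₃ = ∑ (λ i → third (l + (l + i))) k
    X₁ = ∑ gap l
    X₂ = ∑ (λ i → gap (l + i)) (l + k)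
    Y₁ = ∑ gap₂ l
    Y₂ = ∑ (λ i → gap₂ (l + i)) l
    Y₃ = ∑ (λ i → gap₂ (l + (l + i))) k
    regroup : ∀ a b c d e → a + b + (c + (d + e)) ≡ a + (c + e) + (d + b)
    regroup = solve-∀
    regroup′ : ∀ a b c d e → a + (c + e) + (b + d) ≡ b + a + (c + (d + e))
    regroup′ = solve-∀

  bound : n ≤ 2 * ∑ gap n + ∑ gap₂ n
  bound = begin
    n                                      ≡⟨ sym (∑-const-1 n) ⟩
    ∑ (λ _ → 1) n                          ≤⟨ ∑-mono-≤ charge-≥-1 n ⟩
    ∑ (λ u → gap u + second u + third u) n ≡⟨ trans (∑-distrib-+ _ third n) (cong (_+ ∑ third n) (∑-distrib-+ gap second n)) ⟩
    ∑ gap n + ∑ second n + ∑ third n       ≡⟨ +-assoc (∑ gap n) _ _ ⟩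
    ∑ gap n + (∑ second n + ∑ third n)     ≤⟨ +-mono-≤ (≤-refl {∑ gap n}) later-charges-≤ ⟩
    ∑ gap n + (∑ gap n + ∑ gap₂ n)         ≡⟨ double (∑ gap n) (∑ gap₂ n) ⟩
    2 * ∑ gap n + ∑ gap₂ n                 ∎
    where
    open ≤-Reasoning
    double : ∀ a b → a + (a + b) ≡ 2 * a + b
    double = solve-∀

+-shift : ∀ (t : ℤ) p m → t ℤ.+ + p ℤ.+ + m ≡ t ℤ.+ + (p + m)
+-shift t p m = ℤ.+-assoc t (+ p) (+ m)

shifted-avoids : ∀ A l k t → (∀ u → ¬ TranslateIn A l k u) →
  ∀ u → ¬ (A (t ℤ.+ + u) ≡ true × A (t ℤ.+ + (l + u)) ≡ true × A (t ℤ.+ + (l + k + u)) ≡ true)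
shifted-avoids A l k t noTranslate u (Au , Au+l , Au+l+k) =
  noTranslate (t ℤ.+ + u) (Au , trans (cong A u+l) Au+l , trans (cong A u+l+k) Au+l+k)
  where
  u+l : t ℤ.+ + u ℤ.+ + l ≡ t ℤ.+ + (l + u)
  u+l = trans (+-shift t u l) (cong (λ p → t ℤ.+ + p) (+-comm u l))
  u+l+k : t ℤ.+ + u ℤ.+ + l ℤ.+ + k ≡ t ℤ.+ + (l + k + u)
  u+l+k = begin
    t ℤ.+ + u ℤ.+ + l ℤ.+ + k ≡⟨ cong (ℤ._+ + k) (+-shift t u l) ⟩
    t ℤ.+ + (u + l) ℤ.+ + k   ≡⟨ +-shift t (u + l) k ⟩
    t ℤ.+ + (u + l + k)       ≡⟨ cong (λ p → t ℤ.+ + p) (reorder u l k) ⟩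
    t ℤ.+ + (l + k + u)       ∎
    where
    open ≡-Reasoning
    reorder : ∀ u l k → u + l + k ≡ l + k + u
    reorder = solve-∀

proposition4 : (l₁ l₂ : ℕ) → 0 < l₁ → 0 < l₂ → Coprime l₁ l₂ →
    l₁ % 3 ≡ (l₂ + 1) % 3 →
    (A : ℤ → Bool) → (∀ (u : ℤ) → ¬ TranslateIn A l₁ l₂ u) →
    (t : ℤ) →
    2 * l₁ + l₂ ≤ 2 * missing A t (2 * l₁ + l₂) + missing A (t ℤ.+ + (l₁ + l₂)) (2 * l₁ + l₂)
proposition4 l₁ l₂ _ _ _ _ A noTranslate t =
  subst₂ (λ X Y → n ≤ 2 * X + Y) (sym |I₁∖A|) (sym |I₂∖A|) bound
  where
  open Charging (λ p → A (t ℤ.+ + p)) l₁ l₂ (shifted-avoids A l₁ l₂ t noTranslate)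
  |I₁∖A| : missing A t n ≡ ∑ gap n
  |I₁∖A| = missing-as-∑ A t n
  |I₂∖A| : missing A (t ℤ.+ + (l₁ + l₂)) n ≡ ∑ gap₂ n
  |I₂∖A| = trans (missing-as-∑ A (t ℤ.+ + (l₁ + l₂)) n)
                 (∑-cong (λ i → cong (λ z → absent (A z)) (+-shift t (l₁ + l₂) i)) n)
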